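{- Let $\alpha\in\{+,-\}$ and let $G$ be a sublinear $\alpha$-radial with root $r\in V(G)$. Let $F$ be the set of $(\alpha,\alpha)$-edges of $G$. Then $G-F$ is a sublinear $\alpha$-radial with root $r$ that is an $\alpha$-flowgraph (with root $r$).
   Context: A bidirected graph $G$ is a finite graph (loops and parallel edges allowed) with maps $\partial_+,\partial_-:E(G)\to 2^{V(G)}$ such that for each edge $e$ with (possibly identical) ends $u,v$: $\partial_\alpha(e)\subseteq\{u,v\}$, $\partial_+(e)\cup\partial_-(e)=\{u,v\}$, and $\partial_+(e)\cap\partial_-(e)=\emptyset$ if $e$ is not a loop. If $u\in\partial_\alpha(e)$, the sign of $u$ over $e$ is $\alpha$; $-\alpha$ denotes the opposite sign. An edge is a $(\beta,\beta)$-edge if all its ends have sign $\beta$; it is a $(+,-)$-edge if both $\partial_+(e),\partial_-(e)$ are nonempty. A bidirected graph is digraphic if every edge is a $(+,-)$-edge; it is an $\alpha$-flowgraph with root $r$ if it is digraphic and, viewed as the digraph in which each edge is an arc from its end with sign $\alpha$ to its end with sign $-\alpha$, every vertex has a directed trail to $r$. A walk is a sequence $W=(w_1,\dots,w_k)$, $k$ odd, with $w_i$ a vertex for odd $i$ and $w_i$ an edge joining $w_{i-1},w_{i+1}$ for even $i$; a trail has no repeated edge. $W$ is a diwalk if to each traversal of an edge $w_i$ one can assign signs to its end-occurrences equal to the signs of these vertices over $w_i$ (for a $(+,-)$-loop the two assigned signs are distinct), such that at every internal vertex term the signs assigned from the preceding and following edges are distinct. A ditrail is a diwalk that is a trail.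 For $k\ge3$ the sign of $w_1$ (resp. $w_k$) over $W$ is the sign assigned at $w_2$ (resp. $w_{k-1}$); $W$ is an $(\alpha,\beta)$-ditrail if these are $\alpha,\beta$, and an $\alpha$-ditrail if it is an $(\alpha,\beta)$-ditrail for some $\beta$; the trivial ditrail $(v)$ counts as both a $(+,-)$- and a $(-,+)$-ditrail. $G$ is an $\alpha$-radial with root $r$ if every $v$ has an $(\alpha,-\alpha)$-ditrail from $v$ to $r$, and an $\alpha$-semiradial with root $r$ if every $v$ has an $\alpha$-ditrail from $v$ to $r$. An $\alpha$-semiradial is sublinear if there is no $(-\alpha,-\alpha)$-ditrail from any vertex to $r$; a sublinear $\alpha$-radial is a sublinear $\alpha$-semiradial that is an $\alpha$-radial. -}

module Defs where

open import Data.Nat using (ℕ)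
open import Data.Fin using (Fin)
open import Data.Bool using (Bool; true; false; if_then_else_)
open import Data.Product using (Σ; ∃; _×_; _,_; proj₁)
open import Data.List using (List; []; _∷_; map; filter; length; lookup)
open import Data.List.Relation.Unary.Unique.Propositional using (Unique)
open import Data.Fin using () renaming (_≟_ to _≟F_)
open import Data.List using () renaming (allFin to allFinL)
open import Relation.Binary.PropositionalEquality using (_≡_; _≢_)
open import Relation.Nullary using (¬_; Dec; yes; no)
open import Relation.Nullary.Decidable using (_×-dec_; ⌊_⌋; ¬?)
open import Data.Empty using (⊥)

data Sign : Set where
  plus minus : Sign

neg : Sign → Sign
neg plus = minus
neg minus = plus

_≟S_ : (a b : Sign) → Dec (a ≡ b)
plus ≟S plus = yes _≡_.refl
plus ≟S minus = no (λ ())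
minus ≟S plus = no (λ ())
minus ≟S minus = yes _≡_.refl

-- Each edge e has two end-occurrences
-- (v₁ e , s₁ e) and (v₂ e , s₂ e): the vertex and its sign over e.
-- For a non-loop (v₁ e ≢ v₂ e) this is exactly ∂₊, ∂₋ with disjointness;
-- for a loop (v₁ e ≡ v₂ e) the pair of signs encodes a (+,+), (-,-) or
-- (+,-)-loop.

record BGraph : Set where
  field
    V E : ℕ
    v₁ v₂ : Fin E → Fin V
    s₁ s₂ : Fin E → Sign

open BGraph public

module _ (G : BGraph) where

  -- a traversal of an edge: the edge together with a direction
  -- (true: from end 1 to end 2, false: from end 2 to end 1)
  Step : Set
  Step = Fin (E G) × Bool

  src dst : Step → Fin (V G)
  src (e , true) = v₁ G e
  src (e , false) = v₂ G e
  dst (e , true) = v₂ G e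
  dst (e , false) = v₁ G e

  srcSign dstSign : Step → Sign
  srcSign (e , true) = s₁ G e
  srcSign (e , false) = s₂ G e
  dstSign (e , true) = s₂ G e
  dstSign (e , false) = s₁ G e

  -- continuation of a diwalk after the step prev, ending at y
  DiwalkFrom : Step → List Step → Fin (V G) → Set
  DiwalkFrom prev [] y = dst prev ≡ y
  DiwalkFrom prev (s ∷ ss) y =
    src s ≡ dst prev × srcSign s ≢ dstSign prev × DiwalkFrom s ss y

  IsDiwalk : Fin (V G) → List Step → Fin (V G) → Set
  IsDiwalk x [] y = x ≡ y
  IsDiwalk x (s ∷ ss) y = src s ≡ x × DiwalkFrom s ss y

  lastSign : Step → List Step → Sign
  lastSign s [] = dstSign s
  lastSign s (t ∷ ts) = lastSign t ts

  -- sign of the first / last vertex over the walk; the trivial walk is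
  -- both a (+,-) and a (-,+) ditrail
  EndSigns : Sign → Sign → List Step → Set
  EndSigns α β [] = β ≡ neg α
  EndSigns α β (s ∷ ss) = srcSign s ≡ α × lastSign s ss ≡ β

  Ditrail : Sign → Sign → Fin (V G) → Fin (V G) → Set
  Ditrail α β x y = Σ (List Step) λ ss →
    IsDiwalk x ss y × Unique (map proj₁ ss) × EndSigns α β ss

  αDitrail : Sign → Fin (V G) → Fin (V G) → Set
  αDitrail α x y = ∃ λ β → Ditrail α β x y

  IsRadial : Sign → Fin (V G) → Set
  IsRadial α r = ∀ v → Ditrail α (neg α) v r

  IsSemiradial : Sign → Fin (V G) → Set
  IsSemiradial α r = ∀ v → αDitrail α v r

  IsSublinearSemiradial : Sign → Fin (V G) → Set
  IsSublinearSemiradial α r =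
    IsSemiradial α r × (∀ v → ¬ Ditrail (neg α) (neg α) v r)

  IsSublinearRadial : Sign → Fin (V G) → Set
  IsSublinearRadial α r = IsSublinearSemiradial α r × IsRadial α r

  IsDigraphic : Set
  IsDigraphic = ∀ e → s₁ G e ≢ s₂ G e

  -- arc of an edge in the associated digraph: from its end with sign α
  -- to its end with sign -α (meaningful for digraphic graphs)
  arcTail arcHead : Sign → Fin (E G) → Fin (V G)
  arcTail α e = if ⌊ s₁ G e ≟S α ⌋ then v₁ G e else v₂ G e
  arcHead α e = if ⌊ s₁ G e ≟S α ⌋ then v₂ G e else v₁ G e

  IsDirWalk : Sign → Fin (V G) → List (Fin (E G)) → Fin (V G) → Set
  IsDirWalk α x [] y = x ≡ y
  IsDirWalk α x (e ∷ es) y = arcTail α e ≡ x × IsDirWalk α (arcHead α e) es y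

  DirTrail : Sign → Fin (V G) → Fin (V G) → Set
  DirTrail α x y = Σ (List (Fin (E G))) λ es → IsDirWalk α x es y × Unique es

  IsFlowgraph : Sign → Fin (V G) → Set
  IsFlowgraph α r = IsDigraphic × (∀ v → DirTrail α v r)

  IsAAEdge : Sign → Fin (E G) → Set
  IsAAEdge α e = s₁ G e ≡ α × s₂ G e ≡ α

  isAAEdge? : (α : Sign) (e : Fin (E G)) → Dec (IsAAEdge α e)
  isAAEdge? α e = (s₁ G e ≟S α) ×-dec (s₂ G e ≟S α)

  keptEdges : Sign → List (Fin (E G))
  keptEdges α = filter (λ e → ¬? (isAAEdge? α e)) (allFinL (E G))

-- G - F where F is the set of (α,α)-edges of G: same vertices, edges
-- are the kept edges (reindexed by position in keptEdges)
deleteAAEdges : Sign → BGraph → BGraph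
deleteAAEdges α G = record
  { V = V G
  ; E = length (keptEdges G α)
  ; v₁ = λ i → v₁ G (lookup (keptEdges G α) i)
  ; v₂ = λ i → v₂ G (lookup (keptEdges G α) i)
  ; s₁ = λ i → s₁ G (lookup (keptEdges G α) i)
  ; s₂ = λ i → s₂ G (lookup (keptEdges G α) i)
  }

-- Idea.  (1) G has no (-α,-α)-edge e: the radial ditrail from an end of e
-- to r either uses e, and then its suffix starting at e is a (-α,-α)-ditrail
-- to r, or it does not, and then prepending e gives one; both contradict
-- sublinearity.  (2) Hence along any diwalk of G, once a traversal arrives
-- with sign α every later one does too, so an (α,-α)-ditrail never uses an
-- (α,α)-edge.  (3) Ditrails of G using only kept edges are exactly the
-- ditrails of the restriction G - F; so G - F inherits the radial ditrails
-- of G, and sublinearity since its ditrails are ditrails of G.  (4) By (1)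
-- every kept edge is a (+,-)-edge, and in a digraphic graph an α-ditrail is
-- a directed trail of the associated digraph.
module Submission where

open import Defs
open import Data.Fin using (Fin; zero; suc)
open import Data.Fin using () renaming (_≟_ to _≟Fin_)
open import Data.Product using (_×_; Σ; _,_; proj₁; proj₂)
open import Data.Bool using (true; false)
open import Data.Empty using (⊥-elim)
open import Function using (id)
open import Data.List using (List; []; _∷_; map; length; lookup)
open import Data.List using () renaming (allFin to allFinL)
open import Data.List.Properties using (map-∘)
open import Data.List.Relation.Unary.All as All using (All; []; _∷_)
open import Data.List.Relation.Unary.All.Properties.Core using (¬Any⇒All¬)
open import Data.List.Relation.Unary.Any using (here; there; index)
open import Data.List.Relation.Unary.Any.Properties using (lookup-index)
open import Data.List.Relation.Unary.AllPairs using ([]; _∷_)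
open import Data.List.Relation.Unary.Unique.Propositional using (Unique)
import Data.List.Relation.Unary.Unique.Propositional.Properties as Unique
open import Data.List.Membership.Propositional using (_∈_)
open import Data.List.Membership.Propositional.Properties
  using (∈-filter⁺; ∈-filter⁻; ∈-allFin; ∈-lookup)
open import Relation.Binary.PropositionalEquality
  using (_≡_; _≢_; refl; sym; trans; cong; cong₂; subst)
open import Relation.Nullary using (¬_; yes; no)
open import Relation.Nullary.Decidable using (¬?)

a≢neg-a : ∀ a → a ≢ neg a
a≢neg-a plus ()
a≢neg-a minus ()

≢neg⇒≡ : ∀ {a b} → a ≢ neg b → a ≡ b
≢neg⇒≡ {plus} {plus} _ = refl
≢neg⇒≡ {plus} {minus} a≢ = ⊥-elim (a≢ refl)
≢neg⇒≡ {minus} {plus} a≢ = ⊥-elim (a≢ refl)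
≢neg⇒≡ {minus} {minus} _ = refl

≢⇒≡neg : ∀ {a b} → a ≢ b → a ≡ neg b
≢⇒≡neg {plus} {plus} a≢ = ⊥-elim (a≢ refl)
≢⇒≡neg {plus} {minus} _ = refl
≢⇒≡neg {minus} {plus} _ = refl
≢⇒≡neg {minus} {minus} a≢ = ⊥-elim (a≢ refl)

-- Position lookup in a duplicate-free list is injective; this is what makes
-- the relabelling of edges of a restriction preserve trails.
lookup-injective : ∀ {A : Set} {xs : List A} → Unique xs →
  ∀ i j → lookup xs i ≡ lookup xs j → i ≡ j
lookup-injective (_ ∷ _) zero zero _ = refl
lookup-injective (x∉ ∷ _) zero (suc j) eq = ⊥-elim (All.lookup x∉ (∈-lookup j) eq)
lookup-injective (x∉ ∷ _) (suc i) zero eq = ⊥-elim (All.lookup x∉ (∈-lookup i) (sym eq))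
lookup-injective (_ ∷ u) (suc i) (suc j) eq = cong suc (lookup-injective u i j eq)

module _ (K : BGraph) where

  aa-srcSign : ∀ β s → IsAAEdge K β (proj₁ s) → srcSign K s ≡ β
  aa-srcSign β (e , true) (h₁ , h₂) = h₁
  aa-srcSign β (e , false) (h₁ , h₂) = h₂

  aa-dstSign : ∀ β s → IsAAEdge K β (proj₁ s) → dstSign K s ≡ β
  aa-dstSign β (e , true) (h₁ , h₂) = h₂
  aa-dstSign β (e , false) (h₁ , h₂) = h₁

  signs⇒aa : ∀ β s → srcSign K s ≡ β → dstSign K s ≡ β → IsAAEdge K β (proj₁ s)
  signs⇒aa β (e , true) p q = p , q
  signs⇒aa β (e , false) p q = q , p

  suffix-at : ∀ {e y} t ts → DiwalkFrom K t ts y → Unique (map proj₁ (t ∷ ts)) →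
    e ∈ map proj₁ (t ∷ ts) →
    Σ (Step K) λ s → Σ (List (Step K)) λ ss → proj₁ s ≡ e × DiwalkFrom K s ss y ×
      Unique (map proj₁ (s ∷ ss)) × lastSign K s ss ≡ lastSign K t ts
  suffix-at t ts w u (here eq) = t , ts , sym eq , w , u , refl
  suffix-at t (t′ ∷ ts) (_ , _ , w) (_ ∷ u) (there e∈) = suffix-at t′ ts w u e∈

  module Sublinear (α : Sign) (r : Fin (V K)) (radial : IsRadial K α r)
                   (sublinear : ∀ v → ¬ Ditrail K (neg α) (neg α) v r) where

    open import Data.List.Membership.DecPropositional (_≟Fin_ {E K}) using (_∈?_)

    no-neg-edge : ∀ e → ¬ IsAAEdge K (neg α) e
    no-neg-edge e e-aa with radial (v₂ K e)
    ... | ss , _ with e ∈? map proj₁ ss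
    -- the radial ditrail from v₂ uses e: its suffix from e is (-α,-α)
    no-neg-edge e e-aa | t ∷ ts , (_ , w) , u , (_ , last) | yes e∈
      with suffix-at t ts w u e∈
    ... | s , ss , refl , w′ , u′ , last′ =
      sublinear (src K s)
        (s ∷ ss , (refl , w′) , u′ , (aa-srcSign (neg α) s e-aa , trans last′ last))
    -- otherwise traverse e from v₁ to v₂ first; it arrives with -α, and
    -- the radial ditrail leaves v₂ with α
    no-neg-edge e e-aa | [] , d , _ , _ | no _ =
      sublinear (v₁ K e) ((e , true) ∷ [] , (refl , d) , [] ∷ [] , e-aa)
    no-neg-edge e e-aa@(h₁ , h₂) | t ∷ ts , (t-src , w) , u , (first , last) | no e∉ =
      sublinear (v₁ K e)
        ((e , true) ∷ t ∷ ts ,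
         (refl , t-src , (λ q → a≢neg-a α (trans (sym first) (trans q h₂))) , w) ,
         ¬Any⇒All¬ _ e∉ ∷ u , (h₁ , last))

    -- Step (2): without (-α,-α)-edges, arriving with sign α is permanent.
    arrives-α : ∀ p ss {y} → DiwalkFrom K p ss y → dstSign K p ≡ α → lastSign K p ss ≡ α
    arrives-α p [] _ p-α = p-α
    arrives-α p (t ∷ ts) (_ , alternate , w) p-α = arrives-α t ts w t-α
      where
      t-leaves-neg : srcSign K t ≡ neg α
      t-leaves-neg = ≢⇒≡neg (λ q → alternate (trans q (sym p-α)))
      t-α : dstSign K t ≡ α
      t-α = ≢neg⇒≡ (λ q → no-neg-edge (proj₁ t) (signs⇒aa (neg α) t t-leaves-neg q))

    first-not-αα : ∀ p ss {y} → DiwalkFrom K p ss y → lastSign K p ss ≡ neg α →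
      ¬ IsAAEdge K α (proj₁ p)
    first-not-αα p ss w last p-aa =
      a≢neg-a α (trans (sym (arrives-α p ss w (aa-dstSign α p p-aa))) last)

    avoids-αα : ∀ p ss {y} → DiwalkFrom K p ss y → lastSign K p ss ≡ neg α →
      All (λ s → ¬ IsAAEdge K α (proj₁ s)) (p ∷ ss)
    avoids-αα p [] w last = first-not-αα p [] w last ∷ []
    avoids-αα p (t ∷ ts) w@(_ , _ , w′) last =
      first-not-αα p (t ∷ ts) w last ∷ avoids-αα t ts w′ last

    ditrail-avoids-αα : ∀ {β x y} (D : Ditrail K β (neg α) x y) →
      All (λ s → ¬ IsAAEdge K α (proj₁ s)) (proj₁ D)
    ditrail-avoids-αα ([] , _) = []
    ditrail-avoids-αα (t ∷ ts , (_ , w) , _ , (_ , last)) = avoids-αα t ts w last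

    not-αα⇒mixed : ∀ e → ¬ IsAAEdge K α e → s₁ K e ≢ s₂ K e
    not-αα⇒mixed e not-αα s₁≡s₂ with s₁ K e ≟S α
    ... | yes s₁≡α = not-αα (s₁≡α , trans (sym s₁≡s₂) s₁≡α)
    ... | no s₁≢α = no-neg-edge e (s₁≡neg , trans (sym s₁≡s₂) s₁≡neg)
      where
      s₁≡neg : s₁ K e ≡ neg α
      s₁≡neg = ≢⇒≡neg s₁≢α

  module Digraphic (α : Sign) (digraphic : IsDigraphic K) where

    traversal-flips : ∀ s → srcSign K s ≢ dstSign K s
    traversal-flips (e , true) = digraphic e
    traversal-flips (e , false) q = digraphic e (sym q)

    follows-arc : ∀ s → srcSign K s ≡ α →
      arcTail K α (proj₁ s) ≡ src K s × arcHead K α (proj₁ s) ≡ dst K s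
    follows-arc (e , true) s-α with s₁ K e ≟S α
    ... | yes _ = refl , refl
    ... | no s₁≢α = ⊥-elim (s₁≢α s-α)
    follows-arc (e , false) s-α with s₁ K e ≟S α
    ... | yes s₁≡α = ⊥-elim (digraphic e (trans s₁≡α (sym s-α)))
    ... | no _ = refl , refl

    -- Step (4): a diwalk leaving with sign α keeps leaving with sign α, so
    -- it is a directed walk of the associated digraph.
    diwalk⇒dirWalk : ∀ s ss {y} → srcSign K s ≡ α → DiwalkFrom K s ss y →
      IsDirWalk K α (src K s) (proj₁ s ∷ map proj₁ ss) y
    diwalk⇒dirWalk s [] s-α arrive =
      proj₁ (follows-arc s s-α) , trans (proj₂ (follows-arc s s-α)) arrive
    diwalk⇒dirWalk s (t ∷ ts) {y} s-α (t-src , alternate , w) =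
      proj₁ (follows-arc s s-α) ,
      subst (λ z → IsDirWalk K α z (proj₁ t ∷ map proj₁ ts) y)
        (trans t-src (sym (proj₂ (follows-arc s s-α))))
        (diwalk⇒dirWalk t ts t-α w)
      where
      s-arrives-neg : dstSign K s ≡ neg α
      s-arrives-neg = ≢⇒≡neg (λ q → traversal-flips s (trans s-α (sym q)))
      t-α : srcSign K t ≡ α
      t-α = ≢neg⇒≡ (λ q → alternate (trans q (sym s-arrives-neg)))

    ditrail⇒dirTrail : ∀ {β v w} → Ditrail K α β v w → DirTrail K α v w
    ditrail⇒dirTrail ([] , v≡w , _ , _) = [] , v≡w , []
    ditrail⇒dirTrail {w = w} (s ∷ ss , (s-src , walk) , u , (s-α , _)) =
      map proj₁ (s ∷ ss) ,
      subst (λ z → IsDirWalk K α z (map proj₁ (s ∷ ss)) w) s-src (diwalk⇒dirWalk s ss s-α walk) ,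
      u

-- The restriction of G to a list of its edges: same vertices, the i-th
-- edge is the i-th listed edge.  G - F is such a restriction.
restrictEdges : (G : BGraph) → List (Fin (E G)) → BGraph
restrictEdges G ks = record
  { V = V G
  ; E = length ks
  ; v₁ = λ i → v₁ G (lookup ks i)
  ; v₂ = λ i → v₂ G (lookup ks i)
  ; s₁ = λ i → s₁ G (lookup ks i)
  ; s₂ = λ i → s₂ G (lookup ks i)
  }

module Restriction (G : BGraph) (ks : List (Fin (E G))) where

  private
    G′ : BGraph
    G′ = restrictEdges G ks

  ι : Step G′ → Step G
  ι (i , b) = lookup ks i , b

  diwalkFrom-ι : ∀ p ts y → DiwalkFrom G′ p ts y ≡ DiwalkFrom G (ι p) (map ι ts) y
  diwalkFrom-ι (_ , true) [] y = refl
  diwalkFrom-ι (_ , false) [] y = refl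
  diwalkFrom-ι (_ , true) ((_ , true) ∷ ts) y = cong (λ X → _ × _ × X) (diwalkFrom-ι _ ts y)
  diwalkFrom-ι (_ , true) ((_ , false) ∷ ts) y = cong (λ X → _ × _ × X) (diwalkFrom-ι _ ts y)
  diwalkFrom-ι (_ , false) ((_ , true) ∷ ts) y = cong (λ X → _ × _ × X) (diwalkFrom-ι _ ts y)
  diwalkFrom-ι (_ , false) ((_ , false) ∷ ts) y = cong (λ X → _ × _ × X) (diwalkFrom-ι _ ts y)

  isDiwalk-ι : ∀ x ts y → IsDiwalk G′ x ts y ≡ IsDiwalk G x (map ι ts) y
  isDiwalk-ι x [] y = refl
  isDiwalk-ι x ((_ , true) ∷ ts) y = cong (λ X → _ × X) (diwalkFrom-ι _ ts y)
  isDiwalk-ι x ((_ , false) ∷ ts) y = cong (λ X → _ × X) (diwalkFrom-ι _ ts y)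

  lastSign-ι : ∀ p ts → lastSign G′ p ts ≡ lastSign G (ι p) (map ι ts)
  lastSign-ι (_ , true) [] = refl
  lastSign-ι (_ , false) [] = refl
  lastSign-ι p (t ∷ ts) = lastSign-ι t ts

  endSigns-ι : ∀ β γ ts → EndSigns G′ β γ ts ≡ EndSigns G β γ (map ι ts)
  endSigns-ι β γ [] = refl
  endSigns-ι β γ ((_ , true) ∷ ts) = cong (λ c → _ × c ≡ γ) (lastSign-ι _ ts)
  endSigns-ι β γ ((_ , false) ∷ ts) = cong (λ c → _ × c ≡ γ) (lastSign-ι _ ts)

  edges-ι : ∀ ts → map proj₁ (map ι ts) ≡ map (lookup ks) (map proj₁ ts)
  edges-ι ts = trans (sym (map-∘ ts)) (map-∘ ts)

  -- A ditrail of the restriction is a ditrail of G (ι is injective on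
  -- edges when the list has no repetition).
  ditrail-down : Unique ks → ∀ {β γ x y} → Ditrail G′ β γ x y → Ditrail G β γ x y
  ditrail-down ks-unique (ts , walk , u , ends) =
    map ι ts ,
    subst id (isDiwalk-ι _ ts _) walk ,
    subst Unique (sym (edges-ι ts)) (Unique.map⁺ (lookup-injective ks-unique _ _) u) ,
    subst id (endSigns-ι _ _ ts) ends

  lift : ∀ ss → All (λ s → proj₁ s ∈ ks) ss → Σ (List (Step G′)) λ ts → map ι ts ≡ ss
  lift [] [] = [] , refl
  lift ((e , b) ∷ ss) (e∈ ∷ ss∈) =
    (index e∈ , b) ∷ proj₁ (lift ss ss∈) ,
    cong₂ _∷_ (cong (_, b) (sym (lookup-index e∈))) (proj₂ (lift ss ss∈))

  ditrail-up : ∀ {β γ x y} (D : Ditrail G β γ x y) → All (λ s → proj₁ s ∈ ks) (proj₁ D) →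
    Ditrail G′ β γ x y
  ditrail-up (ss , walk , u , ends) ss∈ with lift ss ss∈
  ... | ts , refl =
    ts ,
    subst id (sym (isDiwalk-ι _ ts _)) walk ,
    Unique.map⁻ (subst Unique (edges-ι ts) u) ,
    subst id (sym (endSigns-ι _ _ ts)) ends

module KeptEdges (G : BGraph) (α : Sign) where

  private
    keep? = λ e → ¬? (isAAEdge? G α e)

  kept-unique : Unique (keptEdges G α)
  kept-unique = Unique.filter⁺ keep? (Unique.allFin⁺ (E G))

  kept-complete : ∀ e → ¬ IsAAEdge G α e → e ∈ keptEdges G α
  kept-complete e not-αα = ∈-filter⁺ keep? (∈-allFin e) not-αα

  kept-sound : ∀ i → ¬ IsAAEdge G α (lookup (keptEdges G α) i)
  kept-sound i = proj₂ (∈-filter⁻ keep? {xs = allFinL (E G)} (∈-lookup i))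

lemma11p8 : (α : Sign) (G : BGraph) (r : Fin (V G)) →
    IsSublinearRadial G α r →
    IsSublinearRadial (deleteAAEdges α G) α r × IsFlowgraph (deleteAAEdges α G) α r
lemma11p8 α G r ((_ , sublinear) , radial) =
  (((λ v → neg α , radial′ v) , sublinear′) , radial′) ,
  (digraphic′ , λ v → Digraphic.ditrail⇒dirTrail G′ α digraphic′ (radial′ v))
  where
  open Sublinear G α r radial sublinear
  open KeptEdges G α
  open Restriction G (keptEdges G α)

  G′ : BGraph
  G′ = deleteAAEdges α G

  -- radial ditrails avoid (α,α)-edges, so they survive the deletion
  radial′ : IsRadial G′ α r
  radial′ v = ditrail-up (radial v)
    (All.map (λ {s} → kept-complete (proj₁ s)) (ditrail-avoids-αα (radial v)))

  sublinear′ : ∀ v → ¬ Ditrail G′ (neg α) (neg α) v r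
  sublinear′ v D = sublinear v (ditrail-down kept-unique D)

  digraphic′ : IsDigraphic G′
  digraphic′ i = not-αα⇒mixed (lookup (keptEdges G α) i) (kept-sound i)
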